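{- Let $l\ge2$ be an integer, let $\sigma$ be the substitution on $\{0,1\}$ given by $1\mapsto 1\,0^{l}\,1$, $0\mapsto 0^{l+2}$, let $\mathbf{c}=\sigma^\infty(1)$ be its fixed point beginning with $1$, and let $S=\theta(\mathbf{c})=\{S_0<S_1<\cdots\}$ be the corresponding sum-free set. Let $t_n$ denote the sum of the binary digits of $n$ modulo $2$. (1) If $l$ is odd, then $S_n\equiv 1-t_n \pmod 2$ for all $n\ge0$. (2) If $l$ is even, then $S_{2n}\equiv S_{2n+1}\equiv 1-t_n\pmod 2$ for all $n\ge0$.
   Context: $0^{l}$ denotes a block of $l$ zeros. A set $S$ of positive integers is sum-free if there are no $x,y,z\in S$ ($x,y$ not necessarily distinct) with $x+y=z$. Cameron's bijection $\theta$: given a zero-one sequence $\mathbf{w}$, examine $n=1,2,3,\dots$ in order; if $n=x+y$ for some $x,y$ already placed in $S$, label $n$ by $\ast$ and $n\notin S$; otherwise read the next unread symbol of $\mathbf{w}$ and put $n\in S$ iff it is $1$. Then $\theta(\mathbf{w})=S$, listed increasingly as $S_0<S_1<\cdots$. -}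

module Defs where

open import Data.Nat using (ℕ; zero; suc; _+_; _*_; _∸_; _%_; _/_; _≡ᵇ_)
open import Data.Bool using (Bool; true; false; if_then_else_)
open import Data.List using (List; []; _∷_; _++_; replicate; concatMap)
open import Data.Bool.ListAction using (any)
open import Data.Product using (_×_; _,_; proj₁)
open import Relation.Binary.PropositionalEquality using (_≡_)

σ : ℕ → Bool → List Bool
σ l true  = true ∷ (replicate l false ++ (true ∷ []))
σ l false = replicate (l + 2) false

σIter : ℕ → ℕ → List Bool
σIter l zero    = true ∷ []
σIter l (suc k) = concatMap (σ l) (σIter l k)

-- i-th entry of a list (0-indexed), default false beyond the end
nth : List Bool → ℕ → Bool
nth []       _       = false
nth (b ∷ bs) zero    = b
nth (b ∷ bs) (suc i) = nth bs i

-- The fixed point c = σ^∞(1), as an infinite 0-1 sequence indexed from 0.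
-- σ^(i+1)(1) has length (l+2)^(i+1) > i and is a prefix of c.
fixedPoint : ℕ → ℕ → Bool
fixedPoint l i = nth (σIter l (suc i)) i

isSum : List ℕ → ℕ → Bool
isSum S n = any (λ x → any (λ y → (x + y) ≡ᵇ n) S) S

-- Cameron's bijection θ: state after examining 1, …, n :
-- (elements of S placed so far, number of symbols of w read so far)
θstate : (ℕ → Bool) → ℕ → List ℕ × ℕ
θstate w zero = [] , 0
θstate w (suc n) with θstate w n
... | S , r = if isSum S (suc n) then (S , r)
              else (if w r then (suc n ∷ S , suc r) else (S , suc r))

θmem : (ℕ → Bool) → ℕ → Bool
θmem w m = any (λ x → x ≡ᵇ m) (proj₁ (θstate w m))

θcount : (ℕ → Bool) → ℕ → ℕ
θcount w zero    = 0
θcount w (suc m) = (if θmem w m then 1 else 0) + θcount w m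

-- m is the k-th element S_k (0-indexed, increasing order) of θ(w)
IsNth : (ℕ → Bool) → ℕ → ℕ → Set
IsNth w k m = (θmem w m ≡ true) × (θcount w m ≡ k)

bitSum : ℕ → ℕ → ℕ
bitSum zero    n = 0
bitSum (suc f) n = n % 2 + bitSum f (n / 2)

thueMorse : ℕ → ℕ
thueMorse n = bitSum n n % 2

-- Write T = θ(c) as the union of blocks T_0 = {1}, T_{k+1} = T_k ∪ (a_k + T_k), where m_k = max T_k
-- and a_k > 2 m_k.  Then the sums of T_{k+1} are those of T_k and their translates by a_k and 2 a_k,
-- separated by gaps, so on [1, m_{k+1}] the pattern of sums repeats.  Counting, exactly N_k = (l+2)^k
-- numbers up to m_k are not sums, which is the length of σ^k(1); the non-sums in (m_k, a_k] read the
-- l N_k zeros of σ^{k+1}(1) = σ^k(1) 0^(l N_k) σ^k(1), and reading the second copy of σ^k(1) reproduces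
-- T_k shifted by a_k.  Hence S_{2^k + r} = a_k + S_r for r < 2^k, and since a_k = 3^k + (l+1)(l+2)^k is
-- congruent to 1 + (l+1) 2^k, induction gives S_n ≡ 1 + s₂(n) + (l+1) n (mod 2).
module Submission where

open import Defs
open import Data.Bool using (Bool; true; false; if_then_else_; T; _∧_; _∨_; not)
open import Data.Bool.ListAction using (any)
open import Data.Bool.Properties using (∨-zeroʳ; ∧-zeroʳ; ∧-identityʳ; ∧-distribʳ-∨; T-≡)
open import Data.List using (List; []; _∷_; _++_; replicate; concatMap; length)
open import Data.List.Properties using (++-identityʳ; concatMap-++; length-++; length-replicate)
open import Data.Nat
open import Data.Nat.DivMod
open import Data.Nat.Divisibility using (divides)
open import Data.Nat.Properties
open import Data.Nat.Tactic.RingSolver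
open import Data.Parity.Base as ℙ using (0ℙ; 1ℙ)
open import Data.Parity.Properties using (+-homo-+; *-homo-*)
import Data.Parity.Properties as ℙₚ
open import Data.Product using (Σ; _×_; _,_; proj₁; proj₂; ∃; ∃₂; map₂)
open import Data.Sum using (_⊎_; inj₁; inj₂)
import Data.Sum as Sum
open import Function.Base using (_∘_)
open import Function.Bundles using (_⇔_; mk⇔; Equivalence)
open import Function.Construct.Composition using (_⇔-∘_)
open import Function.Construct.Symmetry using (⇔-sym)
open import Relation.Binary.PropositionalEquality
open import Relation.Nullary using (yes; no; ¬_; contradiction)
open import Algebra.Properties.CommutativeSemigroup +-commutativeSemigroup using (interchange; x∙yz≈y∙xz)

n<m^n : ∀ m n → 1 < m → n < m ^ n
n<m^n m zero 1<m = s≤s z≤n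
n<m^n m@(suc _) (suc n) 1<m = begin-strict
    suc n           <⟨ s≤s (n<m^n m n 1<m) ⟩
    suc (m ^ n)     ≤⟨ +-monoˡ-≤ (m ^ n) (m^n>0 m n) ⟩
    m ^ n + m ^ n   ≤⟨ ≤-reflexive (cong (m ^ n +_) (sym (+-identityʳ (m ^ n)))) ⟩
    2 * m ^ n       ≤⟨ *-monoˡ-≤ (m ^ n) 1<m ⟩
    m ^ suc n       ∎
  where open ≤-Reasoning

nth-++ˡ : ∀ xs ys {i} → i < length xs → nth (xs ++ ys) i ≡ nth xs i
nth-++ˡ (x ∷ xs) ys {zero}  _         = refl
nth-++ˡ (x ∷ xs) ys {suc i} (s≤s i<n) = nth-++ˡ xs ys i<n

nth-++ʳ : ∀ xs ys i → nth (xs ++ ys) (length xs + i) ≡ nth ys i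
nth-++ʳ []       ys i = refl
nth-++ʳ (x ∷ xs) ys i = nth-++ʳ xs ys i

nth-replicate-false : ∀ n i → nth (replicate n false) i ≡ false
nth-replicate-false zero    i       = refl
nth-replicate-false (suc n) zero    = refl
nth-replicate-false (suc n) (suc i) = nth-replicate-false n i

replicate-+ : ∀ {A : Set} m n (x : A) → replicate m x ++ replicate n x ≡ replicate (m + n) x
replicate-+ zero    n x = refl
replicate-+ (suc m) n x = cong (x ∷_) (replicate-+ m n x)

∧-≡-true : ∀ {b c} → b ∧ c ≡ true → b ≡ true × c ≡ true
∧-≡-true {true} {true} _ = refl , refl

anyUpTo : (ℕ → Bool) → ℕ → Bool
anyUpTo f zero    = f zero
anyUpTo f (suc n) = f (suc n) ∨ anyUpTo f n

anyUpTo-sound : ∀ f n → anyUpTo f n ≡ true → ∃ λ i → i ≤ n × f i ≡ true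
anyUpTo-sound f zero    f0 = 0 , z≤n , f0
anyUpTo-sound f (suc n) found with f (suc n) in fn
... | true  = suc n , ≤-refl , fn
... | false = let i , i≤n , fi = anyUpTo-sound f n found in i , m≤n⇒m≤1+n i≤n , fi

anyUpTo-complete : ∀ f {n i} → i ≤ n → f i ≡ true → anyUpTo f n ≡ true
anyUpTo-complete f {zero}  z≤n fi = fi
anyUpTo-complete f {suc n} {i} i≤n fi with i ≟ suc n
... | yes refl = cong (_∨ anyUpTo f n) fi
... | no  i≢n  = trans (cong (f (suc n) ∨_) (anyUpTo-complete f (≤-pred (≤∧≢⇒< i≤n i≢n)) fi)) (∨-zeroʳ (f (suc n)))

true-⇔⇒≡ : ∀ {b c} → (b ≡ true ⇔ c ≡ true) → b ≡ c
true-⇔⇒≡ {false} {false} _   = refl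
true-⇔⇒≡ {true}  {true}  _   = refl
true-⇔⇒≡ {false} {true}  b⇔c = Equivalence.from b⇔c refl
true-⇔⇒≡ {true}  {false} b⇔c = sym (Equivalence.to b⇔c refl)

memᵇ : ℕ → List ℕ → Bool
memᵇ x = any (_≡ᵇ x)

any-sound : ∀ f (xs : List ℕ) → any f xs ≡ true → ∃ λ x → memᵇ x xs ≡ true × f x ≡ true
any-sound f (y ∷ ys) any≡ with f y in fy
... | true  = y , cong (_∨ memᵇ y ys) (Equivalence.to T-≡ (≡⇒≡ᵇ y y refl)) , fy
... | false = let x , x∈ , fx = any-sound f ys any≡ in x , trans (cong ((y ≡ᵇ x) ∨_) x∈) (∨-zeroʳ (y ≡ᵇ x)) , fx

any-complete : ∀ f (xs : List ℕ) {x} → memᵇ x xs ≡ true → f x ≡ true → any f xs ≡ true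
any-complete f (y ∷ ys) {x} x∈ fx with y ≡ᵇ x in y≡x
... | true  = cong (_∨ any f ys) (trans (cong f (≡ᵇ⇒≡ y x (Equivalence.from T-≡ y≡x))) fx)
... | false = trans (cong (f y ∨_) (any-complete f ys x∈ fx)) (∨-zeroʳ (f y))

<ᵇ-suc : ∀ x n → (x <ᵇ suc n) ≡ (n ≡ᵇ x) ∨ (x <ᵇ n)
<ᵇ-suc zero    zero    = refl
<ᵇ-suc zero    (suc n) = refl
<ᵇ-suc (suc x) zero    = refl
<ᵇ-suc (suc x) (suc n) = <ᵇ-suc x n

≤ᵇ-suc : ∀ x n → (x ≤ᵇ suc n) ≡ (suc n ≡ᵇ x) ∨ (x ≤ᵇ n)
≤ᵇ-suc zero    n = refl
≤ᵇ-suc (suc x) n = <ᵇ-suc x n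

≤ᵇ-suc-∧ : ∀ f n x → (x ≤ᵇ suc n) ∧ f x ≡ (suc n ≡ᵇ x) ∧ f (suc n) ∨ (x ≤ᵇ n) ∧ f x
≤ᵇ-suc-∧ f n x = begin
    (x ≤ᵇ suc n) ∧ f x                              ≡⟨ cong (_∧ f x) (≤ᵇ-suc x n) ⟩
    ((suc n ≡ᵇ x) ∨ (x ≤ᵇ n)) ∧ f x                 ≡⟨ ∧-distribʳ-∨ (f x) (suc n ≡ᵇ x) (x ≤ᵇ n) ⟩
    (suc n ≡ᵇ x) ∧ f x ∨ (x ≤ᵇ n) ∧ f x             ≡⟨ cong (_∨ (x ≤ᵇ n) ∧ f x) at-point ⟩
    (suc n ≡ᵇ x) ∧ f (suc n) ∨ (x ≤ᵇ n) ∧ f x ∎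
  where
  open ≡-Reasoning
  at-point : (suc n ≡ᵇ x) ∧ f x ≡ (suc n ≡ᵇ x) ∧ f (suc n)
  at-point with suc n ≡ᵇ x in eq
  ... | false = refl
  ... | true  = cong f (sym (≡ᵇ⇒≡ (suc n) x (Equivalence.from T-≡ eq)))

count : (ℕ → Bool) → ℕ → ℕ
count f zero    = 0
count f (suc n) = (if f n then 1 else 0) + count f n

count-shift : ∀ f x j → (∀ i → i < j → f (x + i) ≡ f i) → count f (x + j) ≡ count f x + count f j
count-shift f x zero    _    = trans (cong (count f) (+-identityʳ x)) (sym (+-identityʳ (count f x)))
count-shift f x (suc j) f≡ = begin
    count f (x + suc j)                           ≡⟨ cong (count f) (+-suc x j) ⟩
    (if f (x + j) then 1 else 0) + count f (x + j)
      ≡⟨ cong₂ (λ b c → (if b then 1 else 0) + c) (f≡ j ≤-refl) (count-shift f x j (λ i i<j → f≡ i (m<n⇒m<1+n i<j))) ⟩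
    (if f j then 1 else 0) + (count f x + count f j) ≡⟨ x∙yz≈y∙xz _ (count f x) (count f j) ⟩
    count f x + count f (suc j) ∎
  where open ≡-Reasoning

count-gap : ∀ f {x y} → x ≤ y → (∀ i → x ≤ i → i < y → f i ≡ false) → count f y ≡ count f x
count-gap f {x} {y} x≤y f≡ with ≤⇒≤′ x≤y
... | ≤′-refl = refl
... | ≤′-step {n = y′} x≤′y′ = cong₂ _+_ (cong (λ b → if b then 1 else 0) (f≡ y′ x≤y′ ≤-refl))
                                         (count-gap f x≤y′ (λ i x≤i i<y′ → f≡ i x≤i (m<n⇒m<1+n i<y′)))
  where x≤y′ = ≤′⇒≤ x≤′y′

count-mono : ∀ f {x y} → x ≤ y → count f x ≤ count f y
count-mono f {x} {y} x≤y with ≤⇒≤′ x≤y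
... | ≤′-refl = ≤-refl
... | ≤′-step {n = y′} x≤′y′ = ≤-trans (count-mono f (≤′⇒≤ x≤′y′)) (m≤n+m (count f y′) _)

count+count-not : ∀ f n → count f n + count (λ i → not (f i)) n ≡ n
count+count-not f zero    = refl
count+count-not f (suc n) with f n
... | true  = cong suc (count+count-not f n)
... | false = trans (+-suc (count f n) _) (cong suc (count+count-not f n))

bitSum-zero : ∀ f → bitSum f 0 ≡ 0
bitSum-zero zero    = refl
bitSum-zero (suc f) = bitSum-zero f

bitSum-fuel : ∀ {f g} n → n ≤ f → n ≤ g → bitSum f n ≡ bitSum g n
bitSum-fuel {f} {g} zero _ _ = trans (bitSum-zero f) (sym (bitSum-zero g))
bitSum-fuel {suc f} {suc g} n@(suc _) (s≤s n≤f) (s≤s n≤g) =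
  cong (n % 2 +_) (bitSum-fuel (n / 2) (half≤ n≤f) (half≤ n≤g))
  where
  half≤ : ∀ {h} → pred n ≤ h → n / 2 ≤ h
  half≤ n≤h = ≤-pred (<-≤-trans (m/n<m n 2 (s≤s (s≤s z≤n))) (s≤s n≤h))

bitSum-suc : ∀ f b n → b < 2 → bitSum (suc f) (b + n * 2) ≡ b + bitSum f n
bitSum-suc f b n b<2 = cong₂ _+_
  (trans ([m+kn]%n≡m%n b n 2) (m<n⇒m%n≡m b<2))
  (cong (bitSum f) (trans (+-distrib-/-∣ʳ b (divides n refl)) (cong₂ _+_ (m<n⇒m/n≡0 b<2) (m*n/n≡m n 2))))

bitSum-2^k+ : ∀ k {f r} → k < f → r < 2 ^ k → bitSum f (2 ^ k + r) ≡ suc (bitSum f r)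
bitSum-2^k+ zero {suc f} {zero} _ _ = refl
bitSum-2^k+ zero {suc f} {suc r} _ (s≤s ())
bitSum-2^k+ (suc k) {suc f} {r} (s≤s k<f) r<2^k+1 = begin
    bitSum (suc f) (2 ^ suc k + r)                  ≡⟨ cong (bitSum (suc f)) (trans (cong (2 ^ suc k +_) r≡) (regroup (2 ^ k) (r % 2) (r / 2))) ⟩
    bitSum (suc f) (r % 2 + (2 ^ k + r / 2) * 2)    ≡⟨ bitSum-suc f (r % 2) _ (m%n<n r 2) ⟩
    r % 2 + bitSum f (2 ^ k + r / 2)                ≡⟨ cong (r % 2 +_) (bitSum-2^k+ k k<f (m<n*o⇒m/o<n r<2^k+1′)) ⟩
    r % 2 + suc (bitSum f (r / 2))                  ≡⟨ +-suc (r % 2) _ ⟩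
    suc (r % 2 + bitSum f (r / 2))                  ≡⟨ cong suc (bitSum-suc f (r % 2) (r / 2) (m%n<n r 2)) ⟨
    suc (bitSum (suc f) (r % 2 + r / 2 * 2))        ≡⟨ cong (suc ∘ bitSum (suc f)) r≡ ⟨
    suc (bitSum (suc f) r) ∎
  where
  open ≡-Reasoning
  r≡ = m≡m%n+[m/n]*n r 2
  r<2^k+1′ : r < 2 ^ k * 2
  r<2^k+1′ = subst (r <_) (*-comm 2 (2 ^ k)) r<2^k+1
  regroup : ∀ p b q → 2 * p + (b + q * 2) ≡ b + (p + q) * 2
  regroup = solve-∀

digitSum : ℕ → ℕ
digitSum n = bitSum n n

bitSum≡digitSum : ∀ {f} n → n ≤ f → bitSum f n ≡ digitSum n
bitSum≡digitSum n n≤f = bitSum-fuel n n≤f ≤-refl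

digitSum-2^k+ : ∀ k {r} → r < 2 ^ k → digitSum (2 ^ k + r) ≡ suc (digitSum r)
digitSum-2^k+ k {r} r<2^k =
  trans (bitSum-2^k+ k (<-≤-trans (n<m^n 2 k (s≤s (s≤s z≤n))) (m≤m+n (2 ^ k) r)) r<2^k)
        (cong suc (bitSum≡digitSum r (m≤n+m r (2 ^ k))))

digitSum-double : ∀ b n → b < 2 → digitSum (b + n * 2) ≡ b + digitSum n
digitSum-double b n b<2 = begin
    bitSum x x          ≡⟨ bitSum-fuel x ≤-refl (n≤1+n x) ⟩
    bitSum (suc x) x    ≡⟨ bitSum-suc x b n b<2 ⟩
    b + bitSum x n      ≡⟨ cong (b +_) (bitSum≡digitSum n (≤-trans (m≤m*n n 2) (m≤n+m (n * 2) b))) ⟩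
    b + digitSum n ∎
  where
  open ≡-Reasoning
  x = b + n * 2

%2-parity : ∀ x → (parity x ≡ 0ℙ × x % 2 ≡ 0) ⊎ (parity x ≡ 1ℙ × x % 2 ≡ 1)
%2-parity zero          = inj₁ (refl , refl)
%2-parity (suc zero)    = inj₂ (refl , refl)
%2-parity (suc (suc x)) = Sum.map (map₂ (trans 2+x%2≡x%2)) (map₂ (trans 2+x%2≡x%2)) (%2-parity x)
  where
  2+x%2≡x%2 : (2 + x) % 2 ≡ x % 2
  2+x%2≡x%2 = trans (cong (_% 2) (+-comm 2 x)) ([m+n]%n≡m%n x 2)

%2≡0⇒parity≡0ℙ : ∀ x → x % 2 ≡ 0 → parity x ≡ 0ℙ
%2≡0⇒parity≡0ℙ x x%2≡0 with %2-parity x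
... | inj₁ (px , _)    = px
... | inj₂ (_ , x%2≡1) with () ← trans (sym x%2≡0) x%2≡1

%2≡1⇒parity≡1ℙ : ∀ x → x % 2 ≡ 1 → parity x ≡ 1ℙ
%2≡1⇒parity≡1ℙ x x%2≡1 with %2-parity x
... | inj₁ (_ , x%2≡0) with () ← trans (sym x%2≡0) x%2≡1
... | inj₂ (px , _)    = px

%2≡1∸%2 : ∀ x y → parity x ≡ parity (1 + y) → x % 2 ≡ 1 ∸ y % 2
%2≡1∸%2 x y px≡p1+y with %2-parity x | %2-parity y
... | inj₁ (_ , x%2) | inj₂ (_ , y%2) = trans x%2 (cong (1 ∸_) (sym y%2))
... | inj₂ (_ , x%2) | inj₁ (_ , y%2) = trans x%2 (cong (1 ∸_) (sym y%2))
... | inj₁ (px , _)  | inj₁ (py , _)  with () ← trans (sym px) (trans px≡p1+y (trans (+-homo-+ 1 y) (cong (1ℙ ℙ.+_) py)))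
... | inj₂ (px , _)  | inj₂ (py , _)  with () ← trans (sym px) (trans px≡p1+y (trans (+-homo-+ 1 y) (cong (1ℙ ℙ.+_) py)))

module FixedPoint (l : ℕ) where

  -- Base 2 + l rather than l + 2, so that it is syntactically nonzero.
  N : ℕ → ℕ
  N k = (2 + l) ^ k

  zeros : ℕ → List Bool
  zeros k = replicate (l * N k) false

  concatMap-σ-zeros : ∀ n → concatMap (σ l) (replicate n false) ≡ replicate (n * (l + 2)) false
  concatMap-σ-zeros zero    = refl
  concatMap-σ-zeros (suc n) =
    trans (cong (replicate (l + 2) false ++_) (concatMap-σ-zeros n)) (replicate-+ (l + 2) (n * (l + 2)) false)

  σIter-suc : ∀ k → σIter l (suc k) ≡ σIter l k ++ zeros k ++ σIter l k
  σIter-suc zero = trans (++-identityʳ _) (cong (λ t → true ∷ replicate t false ++ true ∷ []) (sym (*-identityʳ l)))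
  σIter-suc (suc k) = begin
      concatMap (σ l) (σIter l (suc k))
        ≡⟨ cong (concatMap (σ l)) (σIter-suc k) ⟩
      concatMap (σ l) (σIter l k ++ zeros k ++ σIter l k)
        ≡⟨ concatMap-++ (σ l) (σIter l k) _ ⟩
      σIter l (suc k) ++ concatMap (σ l) (zeros k ++ σIter l k)
        ≡⟨ cong (σIter l (suc k) ++_) (concatMap-++ (σ l) (zeros k) _) ⟩
      σIter l (suc k) ++ concatMap (σ l) (zeros k) ++ σIter l (suc k)
        ≡⟨ cong (λ t → σIter l (suc k) ++ t ++ σIter l (suc k)) (concatMap-σ-zeros (l * N k)) ⟩
      σIter l (suc k) ++ replicate (l * N k * (l + 2)) false ++ σIter l (suc k)
        ≡⟨ cong (λ t → σIter l (suc k) ++ replicate t false ++ σIter l (suc k)) (lN-scale l (N k)) ⟩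
      σIter l (suc k) ++ zeros (suc k) ++ σIter l (suc k) ∎
    where
    open ≡-Reasoning
    lN-scale : ∀ x y → x * y * (x + 2) ≡ x * ((2 + x) * y)
    lN-scale = solve-∀

  N-suc : ∀ k → N (suc k) ≡ N k + l * N k + N k
  N-suc k = three-parts l (N k)
    where
    three-parts : ∀ x y → (2 + x) * y ≡ y + x * y + y
    three-parts = solve-∀

  length-σIter : ∀ k → length (σIter l k) ≡ N k
  length-σIter zero = refl
  length-σIter (suc k) = begin
      length (σIter l (suc k))                             ≡⟨ cong length (σIter-suc k) ⟩
      length (σIter l k ++ zeros k ++ σIter l k)           ≡⟨ length-++ (σIter l k) ⟩
      length (σIter l k) + length (zeros k ++ σIter l k)   ≡⟨ cong (length (σIter l k) +_) (length-++ (zeros k)) ⟩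
      length (σIter l k) + (length (zeros k) + length (σIter l k))
        ≡⟨ cong₂ (λ u v → u + (v + u)) (length-σIter k) (length-replicate (l * N k)) ⟩
      N k + (l * N k + N k)                                ≡⟨ +-assoc (N k) _ (N k) ⟨
      N k + l * N k + N k                                  ≡⟨ N-suc k ⟨
      N (suc k) ∎
    where open ≡-Reasoning

  N-mono : ∀ {j k} → j ≤ k → N j ≤ N k
  N-mono = ^-monoʳ-≤ (2 + l)

  nth-σIter-suc : ∀ k {i} → i < N k → nth (σIter l (suc k)) i ≡ nth (σIter l k) i
  nth-σIter-suc k {i} i<N = trans (cong (λ t → nth t i) (σIter-suc k))
                                  (nth-++ˡ (σIter l k) _ (subst (i <_) (sym (length-σIter k)) i<N))

  nth-σIter-stable : ∀ {j k i} → j ≤′ k → i < N j → nth (σIter l k) i ≡ nth (σIter l j) i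
  nth-σIter-stable ≤′-refl         i<N = refl
  nth-σIter-stable {k = suc k} (≤′-step j≤′k) i<N =
    trans (nth-σIter-suc k (<-≤-trans i<N (N-mono (≤′⇒≤ j≤′k)))) (nth-σIter-stable j≤′k i<N)

  fixedPoint-prefix : ∀ k {i} → i < N k → fixedPoint l i ≡ nth (σIter l k) i
  fixedPoint-prefix k {i} i<N with ≤-total k (suc i)
  ... | inj₁ k≤ = nth-σIter-stable (≤⇒≤′ k≤) i<N
  ... | inj₂ ≥k = sym (nth-σIter-stable (≤⇒≤′ ≥k) (<-≤-trans (n<m^n (2 + l) i (s≤s (s≤s z≤n))) (N-mono (n≤1+n i))))

  fixedPoint-zeros : ∀ k {j} → j < l * N k → fixedPoint l (N k + j) ≡ false
  fixedPoint-zeros k {j} j<lN = begin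
      fixedPoint l (N k + j)                              ≡⟨ fixedPoint-prefix (suc k) inside ⟩
      nth (σIter l (suc k)) (N k + j)                     ≡⟨ cong (λ t → nth t (N k + j)) (σIter-suc k) ⟩
      nth (σIter l k ++ zeros k ++ σIter l k) (N k + j)
        ≡⟨ cong (λ t → nth (σIter l k ++ zeros k ++ σIter l k) (t + j)) (sym (length-σIter k)) ⟩
      nth (σIter l k ++ zeros k ++ σIter l k) (length (σIter l k) + j) ≡⟨ nth-++ʳ (σIter l k) _ j ⟩
      nth (zeros k ++ σIter l k) j       ≡⟨ nth-++ˡ (zeros k) _ (subst (j <_) (sym (length-replicate (l * N k))) j<lN) ⟩
      nth (zeros k) j                    ≡⟨ nth-replicate-false (l * N k) j ⟩
      false ∎
    where
    open ≡-Reasoning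
    inside : N k + j < N (suc k)
    inside = <-≤-trans (+-monoʳ-< (N k) j<lN) (≤-trans (m≤m+n _ (N k)) (≤-reflexive (sym (N-suc k))))

  fixedPoint-repeat : ∀ k {i} → i < N k → fixedPoint l (N k + l * N k + i) ≡ fixedPoint l i
  fixedPoint-repeat k {i} i<N = begin
      fixedPoint l (N k + l * N k + i)                       ≡⟨ fixedPoint-prefix (suc k) inside ⟩
      nth (σIter l (suc k)) (N k + l * N k + i)              ≡⟨ cong₂ nth (σIter-suc k) (+-assoc (N k) _ i) ⟩
      nth (σIter l k ++ zeros k ++ σIter l k) (N k + (l * N k + i))
        ≡⟨ cong₂ (λ u v → nth (σIter l k ++ zeros k ++ σIter l k) (u + (v + i)))
                 (sym (length-σIter k)) (sym (length-replicate (l * N k))) ⟩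
      nth (σIter l k ++ zeros k ++ σIter l k) (length (σIter l k) + (length (zeros k) + i))
        ≡⟨ nth-++ʳ (σIter l k) _ _ ⟩
      nth (zeros k ++ σIter l k) (length (zeros k) + i)      ≡⟨ nth-++ʳ (zeros k) _ i ⟩
      nth (σIter l k) i                                      ≡⟨ sym (fixedPoint-prefix k i<N) ⟩
      fixedPoint l i ∎
    where
    open ≡-Reasoning
    inside : N k + l * N k + i < N (suc k)
    inside = subst (N k + l * N k + i <_) (sym (N-suc k)) (+-monoʳ-< (N k + l * N k) i<N)

module SumFreeBlocks (l : ℕ) (2≤l : 2 ≤ l) where
  open FixedPoint l public

  -- inBlock k is the indicator of the block T_k ⊆ [1, m k] (T_0 = {1}, T_{k+1} = T_k ∪ (a k + T_k));
  -- D k and E k count the sums of two elements of T_k lying in [1, m k] and in (m k, 2 m k].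
  D E : ℕ → ℕ
  D zero    = 0
  D (suc k) = D k + D k + E k
  E zero    = 1
  E (suc k) = D k + E k + E k

  a m : ℕ → ℕ
  a k = m k + E k + l * N k
  m zero    = 1
  m (suc k) = m k + a k

  m≡D+N : ∀ k → m k ≡ D k + N k
  m≡D+N zero    = refl
  m≡D+N (suc k) = begin
      m k + (m k + E k + l * N k)              ≡⟨ cong (λ t → t + (t + E k + l * N k)) (m≡D+N k) ⟩
      D k + N k + (D k + N k + E k + l * N k)  ≡⟨ regroup (D k) (E k) (N k) l ⟩
      D k + D k + E k + (2 + l) * N k ∎
    where
    open ≡-Reasoning
    regroup : ∀ d e n x → d + n + (d + n + e + x * n) ≡ d + d + e + (2 + x) * n
    regroup = solve-∀

  D+E≡3^k : ∀ k → D k + E k ≡ 3 ^ k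
  D+E≡3^k zero    = refl
  D+E≡3^k (suc k) = trans (triple (D k) (E k)) (cong (3 *_) (D+E≡3^k k))
    where
    triple : ∀ d e → d + d + e + (d + e + e) ≡ 3 * (d + e)
    triple = solve-∀

  D+E≤N : ∀ k → D k + E k ≤ N k
  D+E≤N k = subst (_≤ N k) (sym (D+E≡3^k k)) (^-monoˡ-≤ k (+-monoʳ-≤ 2 (≤-trans (s≤s z≤n) 2≤l)))

  E-pos : ∀ k → 1 ≤ E k
  E-pos zero    = ≤-refl
  E-pos (suc k) = ≤-trans (E-pos k) (m≤n+m (E k) (D k + E k))

  m-pos : ∀ k → 1 ≤ m k
  m-pos zero    = ≤-refl
  m-pos (suc k) = ≤-trans (m-pos k) (m≤m+n (m k) (a k))

  m≤a : ∀ k → m k ≤ a k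
  m≤a k = ≤-trans (m≤m+n (m k) (E k)) (m≤m+n _ (l * N k))

  m≤lN : ∀ k → m k ≤ l * N k
  m≤lN k = begin
      m k             ≡⟨ m≡D+N k ⟩
      D k + N k       ≤⟨ +-monoˡ-≤ (N k) (≤-trans (m≤m+n (D k) (E k)) (D+E≤N k)) ⟩
      N k + N k       ≡⟨ cong (N k +_) (sym (+-identityʳ (N k))) ⟩
      2 * N k         ≤⟨ *-monoˡ-≤ (N k) 2≤l ⟩
      l * N k ∎
    where open ≤-Reasoning

  m+m<a : ∀ k → m k + m k < a k
  m+m<a k = begin-strict
      m k + m k                 <⟨ +-monoʳ-< (m k) (s≤s (m≤lN k)) ⟩
      m k + suc (l * N k)       ≤⟨ +-monoʳ-≤ (m k) (+-monoˡ-≤ (l * N k) (E-pos k)) ⟩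
      m k + (E k + l * N k)     ≡⟨ +-assoc (m k) (E k) _ ⟨
      a k ∎
    where open ≤-Reasoning

  k<m : ∀ k → k < m k
  k<m zero    = ≤-refl
  k<m (suc k) = ≤-trans (s≤s (k<m k))
    (≤-trans (+-monoˡ-≤ (m k) (≤-trans (m-pos k) (m≤a k))) (≤-reflexive (+-comm (a k) (m k))))

  a-mono : ∀ {j k} → j ≤′ k → a j ≤ a k
  a-mono ≤′-refl         = ≤-refl
  a-mono {k = suc k} (≤′-step j≤′k) = ≤-trans (a-mono j≤′k) (≤-trans (m≤n+m (a k) (m k)) (m≤a (suc k)))

  inBlock : ℕ → ℕ → Bool
  inBlock zero    x = x ≡ᵇ 1
  inBlock (suc k) x with x ≤? m k
  ... | yes _ = inBlock k x
  ... | no  _ with x ≤? a k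
  ...   | yes _ = false
  ...   | no  _ = inBlock k (x ∸ a k)

  inBlock-bounds : ∀ k x → inBlock k x ≡ true → 1 ≤ x × x ≤ m k
  inBlock-bounds zero x x∈ with ≡ᵇ⇒≡ x 1 (subst T (sym x∈) _)
  ... | refl = ≤-refl , ≤-refl
  inBlock-bounds (suc k) x x∈ with x ≤? m k
  ... | yes x≤m = proj₁ (inBlock-bounds k x x∈) , ≤-trans x≤m (m≤m+n (m k) (a k))
  ... | no  x≰m with x ≤? a k
  ...   | no x≰a = ≤-trans (s≤s z≤n) a<x , (begin
      x               ≡⟨ m∸n+n≡m (<⇒≤ a<x) ⟨
      x ∸ a k + a k   ≤⟨ +-monoˡ-≤ (a k) (proj₂ (inBlock-bounds k (x ∸ a k) x∈)) ⟩
      m k + a k ∎)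
    where
    open ≤-Reasoning
    a<x = ≰⇒> x≰a

  inBlock-above : ∀ k {x} → m k < x → inBlock k x ≡ false
  inBlock-above k {x} m<x with inBlock k x in x∈
  ... | false = refl
  ... | true  = contradiction (proj₂ (inBlock-bounds k x x∈)) (<⇒≱ m<x)

  inBlock-zero : ∀ k → inBlock k 0 ≡ false
  inBlock-zero k with inBlock k 0 in 0∈
  ... | false = refl
  ... | true with () ← proj₁ (inBlock-bounds k 0 0∈)

  inBlock-suc-low : ∀ k {x} → x ≤ m k → inBlock (suc k) x ≡ inBlock k x
  inBlock-suc-low k {x} x≤m with x ≤? m k
  ... | yes _   = refl
  ... | no  x≰m = contradiction x≤m x≰m

  inBlock-suc-gap : ∀ k {x} → m k < x → x ≤ a k → inBlock (suc k) x ≡ false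
  inBlock-suc-gap k {x} m<x x≤a with x ≤? m k
  ... | yes x≤m = contradiction x≤m (<⇒≱ m<x)
  ... | no  _ with x ≤? a k
  ...   | yes _   = refl
  ...   | no  x≰a = contradiction x≤a x≰a

  inBlock-suc-shift : ∀ k y → inBlock (suc k) (a k + y) ≡ inBlock k y
  inBlock-suc-shift k y with a k + y ≤? m k
  ... | yes a+y≤m = contradiction (≤-trans (m≤m+n (a k) y) a+y≤m) (<⇒≱ (≤-<-trans (m≤m+n (m k) (m k)) (m+m<a k)))
  ... | no  _ with a k + y ≤? a k
  ...   | no  _ = cong (inBlock k) (m+n∸m≡n (a k) y)
  ...   | yes a+y≤a with y
  ...     | zero   = sym (inBlock-zero k)
  ...     | suc y′ = contradiction a+y≤a (<⇒≱ (m<m+n (a k) z<s))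

  inBlock-suc : ∀ k {x} → x ≤ a k → inBlock (suc k) x ≡ inBlock k x
  inBlock-suc k {x} x≤a with ≤-<-connex x (m k)
  ... | inj₁ x≤m = inBlock-suc-low k x≤m
  ... | inj₂ m<x = trans (inBlock-suc-gap k m<x x≤a) (sym (inBlock-above k m<x))

  inBlock-stable : ∀ {j k x} → j ≤′ k → x ≤ a j → inBlock k x ≡ inBlock j x
  inBlock-stable ≤′-refl x≤a = refl
  inBlock-stable {k = suc k} (≤′-step j≤′k) x≤a =
    trans (inBlock-suc k (≤-trans x≤a (a-mono j≤′k))) (inBlock-stable j≤′k x≤a)

  -- The block x already decides x, because x < m x ≤ a x.
  inT : ℕ → Bool
  inT x = inBlock x x

  inT-inBlock : ∀ k {x} → x ≤ a k → inT x ≡ inBlock k x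
  inT-inBlock k {x} x≤a with ≤-total k x
  ... | inj₁ k≤x = inBlock-stable (≤⇒≤′ k≤x) x≤a
  ... | inj₂ x≤k = sym (inBlock-stable (≤⇒≤′ x≤k) (≤-trans (<⇒≤ (k<m x)) (m≤a x)))

  inBlock-suc-cases : ∀ k {x} → inBlock (suc k) x ≡ true →
                      inBlock k x ≡ true ⊎ ∃ λ y → x ≡ a k + y × inBlock k y ≡ true
  inBlock-suc-cases k {x} x∈ with ≤-<-connex x (m k)
  ... | inj₁ x≤m = inj₁ (trans (sym (inBlock-suc-low k x≤m)) x∈)
  ... | inj₂ m<x with ≤-<-connex x (a k)
  ...   | inj₁ x≤a = contradiction (trans (sym x∈) (inBlock-suc-gap k m<x x≤a)) λ ()
  ...   | inj₂ a<x = inj₂ (x ∸ a k , sym x≡a+y , trans (sym (inBlock-suc-shift k (x ∸ a k))) (trans (cong (inBlock (suc k)) x≡a+y) x∈))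
    where x≡a+y = m+[n∸m]≡n (<⇒≤ a<x)

  inBlock-lift : ∀ k {x} → inBlock k x ≡ true → inBlock (suc k) x ≡ true
  inBlock-lift k {x} x∈ = trans (inBlock-suc-low k (proj₂ (inBlock-bounds k x x∈))) x∈

  inBlock-shift : ∀ k {y} → inBlock k y ≡ true → inBlock (suc k) (a k + y) ≡ true
  inBlock-shift k {y} y∈ = trans (inBlock-suc-shift k y) y∈

  IsBlockSum : ℕ → ℕ → Set
  IsBlockSum k s = ∃₂ λ x y → inBlock k x ≡ true × inBlock k y ≡ true × x + y ≡ s

  IsSum : ℕ → Set
  IsSum s = ∃₂ λ x y → inT x ≡ true × inT y ≡ true × x + y ≡ s

  blockSum-bounds : ∀ k {s} → IsBlockSum k s → 2 ≤ s × s ≤ m k + m k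
  blockSum-bounds k (x , y , x∈ , y∈ , refl) with inBlock-bounds k x x∈ | inBlock-bounds k y y∈
  ... | 1≤x , x≤m | 1≤y , y≤m = +-mono-≤ 1≤x 1≤y , +-mono-≤ x≤m y≤m

  IsSum⇔IsBlockSum : ∀ k {s} → s ≤ a k → IsSum s ⇔ IsBlockSum k s
  IsSum⇔IsBlockSum k {s} s≤a = mk⇔
    (λ { (x , y , x∈ , y∈ , refl) → x , y , trans (sym (inT≡ (m≤m+n x y))) x∈ , trans (sym (inT≡ (m≤n+m y x))) y∈ , refl })
    (λ { (x , y , x∈ , y∈ , refl) → x , y , trans (inT≡ (m≤m+n x y)) x∈ , trans (inT≡ (m≤n+m y x)) y∈ , refl })
    where
    inT≡ : ∀ {x} → x ≤ s → inT x ≡ inBlock k x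
    inT≡ x≤s = inT-inBlock k (≤-trans x≤s s≤a)

  blockSum-suc-cases : ∀ k {s} → IsBlockSum (suc k) s →
    IsBlockSum k s ⊎ (∃ λ j → s ≡ a k + j × IsBlockSum k j) ⊎ (∃ λ j → s ≡ a k + a k + j × IsBlockSum k j)
  blockSum-suc-cases k (x , y , x∈ , y∈ , refl) with inBlock-suc-cases k x∈ | inBlock-suc-cases k y∈
  ... | inj₁ x∈′ | inj₁ y∈′ = inj₁ (x , y , x∈′ , y∈′ , refl)
  ... | inj₁ x∈′ | inj₂ (y′ , refl , y∈′) = inj₂ (inj₁ (x + y′ , x∙yz≈y∙xz x (a k) y′ , x , y′ , x∈′ , y∈′ , refl))
  ... | inj₂ (x′ , refl , x∈′) | inj₁ y∈′ = inj₂ (inj₁ (x′ + y , +-assoc (a k) x′ y , x′ , y , x∈′ , y∈′ , refl))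
  ... | inj₂ (x′ , refl , x∈′) | inj₂ (y′ , refl , y∈′) =
    inj₂ (inj₂ (x′ + y′ , interchange (a k) x′ (a k) y′ , x′ , y′ , x∈′ , y∈′ , refl))

  blockSum-shift : ∀ k {j} → IsBlockSum k j → IsBlockSum (suc k) (a k + j)
  blockSum-shift k (x , y , x∈ , y∈ , refl) = a k + x , y , inBlock-shift k x∈ , inBlock-lift k y∈ , +-assoc (a k) x y

  blockSum-shift₂ : ∀ k {j} → IsBlockSum k j → IsBlockSum (suc k) (a k + a k + j)
  blockSum-shift₂ k (x , y , x∈ , y∈ , refl) = a k + x , a k + y , inBlock-shift k x∈ , inBlock-shift k y∈ , interchange (a k) x (a k) y

  blockSum-suc-low : ∀ k {s} → s ≤ a k + 1 → IsBlockSum (suc k) s → IsBlockSum k s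
  blockSum-suc-low k s≤a+1 σ with blockSum-suc-cases k σ
  ... | inj₁ σ′ = σ′
  ... | inj₂ (inj₁ (j , refl , σ′)) =
    contradiction s≤a+1 (<⇒≱ (+-monoʳ-< (a k) (proj₁ (blockSum-bounds k σ′))))
  ... | inj₂ (inj₂ (j , refl , σ′)) =
    contradiction s≤a+1 (<⇒≱ (<-≤-trans (+-monoʳ-< (a k) (proj₁ (blockSum-bounds k σ′))) (+-monoˡ-≤ j (m≤m+n (a k) (a k)))))

  blockSum-suc-middle : ∀ k {j} → j ≤ a k + 1 → IsBlockSum (suc k) (a k + j) → IsBlockSum k j
  blockSum-suc-middle k {j} j≤a+1 σ with blockSum-suc-cases k σ
  ... | inj₁ σ′ = contradiction (m≤m+n (a k) j) (<⇒≱ (≤-<-trans (proj₂ (blockSum-bounds k σ′)) (m+m<a k)))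
  ... | inj₂ (inj₁ (j′ , eq , σ′)) = subst (IsBlockSum k) (sym (+-cancelˡ-≡ (a k) j j′ eq)) σ′
  ... | inj₂ (inj₂ (j′ , eq , σ′)) = contradiction (subst (_≤ a k + 1) j≡a+j′ j≤a+1)
                                                   (<⇒≱ (+-monoʳ-< (a k) (proj₁ (blockSum-bounds k σ′))))
    where j≡a+j′ = +-cancelˡ-≡ (a k) j (a k + j′) (trans eq (+-assoc (a k) (a k) j′))

  blockSum-suc-high : ∀ k {j} → IsBlockSum (suc k) (a k + a k + j) → IsBlockSum k j
  blockSum-suc-high k {j} σ with blockSum-suc-cases k σ
  ... | inj₁ σ′ = contradiction (≤-trans (m≤m+n (a k) (a k)) (m≤m+n (a k + a k) j))
                                (<⇒≱ (≤-<-trans (proj₂ (blockSum-bounds k σ′)) (m+m<a k)))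
  ... | inj₂ (inj₁ (j′ , eq , σ′)) = contradiction (subst (a k ≤_) j′≡a+j (m≤m+n (a k) j))
                                                   (<⇒≱ (≤-<-trans (proj₂ (blockSum-bounds k σ′)) (m+m<a k)))
    where j′≡a+j = +-cancelˡ-≡ (a k) (a k + j) j′ (trans (sym (+-assoc (a k) (a k) j)) eq)
  ... | inj₂ (inj₂ (j′ , eq , σ′)) = subst (IsBlockSum k) (sym (+-cancelˡ-≡ (a k + a k) j j′ eq)) σ′

  ¬blockSum-gap₁ : ∀ k {s} → m k + m k < s → s ≤ a k + 1 → ¬ IsBlockSum (suc k) s
  ¬blockSum-gap₁ k m+m<s s≤a+1 σ = <⇒≱ m+m<s (proj₂ (blockSum-bounds k (blockSum-suc-low k s≤a+1 σ)))

  ¬blockSum-gap₂ : ∀ k {s} → a k + (m k + m k) < s → s ≤ a k + a k + 1 → ¬ IsBlockSum (suc k) s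
  ¬blockSum-gap₂ k a+m+m<s s≤2a+1 σ with blockSum-suc-cases k σ
  ... | inj₁ σ′ = <⇒≱ a+m+m<s (≤-trans (proj₂ (blockSum-bounds k σ′)) (m≤n+m _ (a k)))
  ... | inj₂ (inj₁ (j , refl , σ′)) = <⇒≱ a+m+m<s (+-monoʳ-≤ (a k) (proj₂ (blockSum-bounds k σ′)))
  ... | inj₂ (inj₂ (j , refl , σ′)) = <⇒≱ (+-monoʳ-< (a k + a k) (proj₁ (blockSum-bounds k σ′))) s≤2a+1

  a+a+m+m≤a : ∀ k → a k + a k + (m k + m k) ≤ a (suc k)
  a+a+m+m≤a k = subst (_≤ a (suc k)) (regroup (m k) (a k)) (<⇒≤ (m+m<a (suc k)))
    where
    regroup : ∀ u v → u + v + (u + v) ≡ v + v + (u + u)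
    regroup = solve-∀

  toBlock : ∀ k {s} → s ≤ a k → IsSum s → IsBlockSum k s
  toBlock k s≤a = Equivalence.to (IsSum⇔IsBlockSum k s≤a)

  fromBlock : ∀ k {s} → s ≤ a k → IsBlockSum k s → IsSum s
  fromBlock k s≤a = Equivalence.from (IsSum⇔IsBlockSum k s≤a)

  IsSum-shift₁ : ∀ k {j} → j ≤ m k + m k → IsSum (a k + j) ⇔ IsSum j
  IsSum-shift₁ k {j} j≤m+m = mk⇔
    (λ σ → fromBlock k j≤a (blockSum-suc-middle k (≤-trans j≤a (m≤m+n (a k) 1)) (toBlock (suc k) a+j≤a′ σ)))
    (λ σ → fromBlock (suc k) a+j≤a′ (blockSum-shift k (toBlock k j≤a σ)))
    where
    j≤a = ≤-trans j≤m+m (<⇒≤ (m+m<a k))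
    a+j≤a′ : a k + j ≤ a (suc k)
    a+j≤a′ = ≤-trans (+-mono-≤ (m≤m+n (a k) (a k)) j≤m+m) (a+a+m+m≤a k)

  IsSum-shift₂ : ∀ k {j} → j ≤ m k + m k → IsSum (a k + a k + j) ⇔ IsSum j
  IsSum-shift₂ k {j} j≤m+m = mk⇔
    (λ σ → fromBlock k j≤a (blockSum-suc-high k (toBlock (suc k) 2a+j≤a′ σ)))
    (λ σ → fromBlock (suc k) 2a+j≤a′ (blockSum-shift₂ k (toBlock k j≤a σ)))
    where
    j≤a = ≤-trans j≤m+m (<⇒≤ (m+m<a k))
    2a+j≤a′ : a k + a k + j ≤ a (suc k)
    2a+j≤a′ = ≤-trans (+-monoʳ-≤ (a k + a k) j≤m+m) (a+a+m+m≤a k)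

  ¬IsSum-gap₁ : ∀ k {s} → m k + m k < s → s ≤ a k + 1 → ¬ IsSum s
  ¬IsSum-gap₁ k {s} m+m<s s≤a+1 σ = ¬blockSum-gap₁ k m+m<s s≤a+1 (toBlock (suc k) s≤a′ σ)
    where
    s≤a′ : s ≤ a (suc k)
    s≤a′ = ≤-trans s≤a+1 (≤-trans (+-mono-≤ (m≤m+n (a k) (a k)) (≤-trans (m-pos k) (m≤m+n (m k) (m k)))) (a+a+m+m≤a k))

  ¬IsSum-gap₂ : ∀ k {s} → a k + (m k + m k) < s → s ≤ a k + a k + 1 → ¬ IsSum s
  ¬IsSum-gap₂ k {s} a+m+m<s s≤2a+1 σ = ¬blockSum-gap₂ k a+m+m<s s≤2a+1 (toBlock (suc k) s≤a′ σ)
    where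
    s≤a′ : s ≤ a (suc k)
    s≤a′ = ≤-trans s≤2a+1 (≤-trans (+-monoʳ-≤ (a k + a k) (≤-trans (m-pos k) (m≤m+n (m k) (m k)))) (a+a+m+m≤a k))

  ¬IsSum-1 : ¬ IsSum 1
  ¬IsSum-1 σ = <⇒≱ ≤-refl (proj₁ (blockSum-bounds 0 (toBlock 0 (s≤s z≤n) σ)))

  IsSum-2 : IsSum 2
  IsSum-2 = fromBlock 0 (s≤s (s≤s z≤n)) (1 , 1 , refl , refl , refl)

  isSumᵇ : ℕ → Bool
  isSumᵇ s = anyUpTo (λ x → inT x ∧ inT (s ∸ x)) s

  isSumᵇ-sound : ∀ {s} → isSumᵇ s ≡ true → IsSum s
  isSumᵇ-sound {s} σ with anyUpTo-sound _ s σ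
  ... | x , x≤s , x,s∸x∈ = let x∈ , s∸x∈ = ∧-≡-true x,s∸x∈ in x , s ∸ x , x∈ , s∸x∈ , m+[n∸m]≡n x≤s

  isSumᵇ-complete : ∀ {s} → IsSum s → isSumᵇ s ≡ true
  isSumᵇ-complete (x , y , x∈ , y∈ , refl) =
    anyUpTo-complete _ (m≤m+n x y) (cong₂ _∧_ x∈ (trans (cong inT (m+n∸m≡n x y)) y∈))

  isSumᵇ⇔IsSum : ∀ {s} → isSumᵇ s ≡ true ⇔ IsSum s
  isSumᵇ⇔IsSum = mk⇔ isSumᵇ-sound isSumᵇ-complete

  isSumᵇ-cong : ∀ {s t} → IsSum s ⇔ IsSum t → isSumᵇ s ≡ isSumᵇ t
  isSumᵇ-cong s⇔t = true-⇔⇒≡ (⇔-sym isSumᵇ⇔IsSum ⇔-∘ (s⇔t ⇔-∘ isSumᵇ⇔IsSum))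

  isSumᵇ-false : ∀ {s} → ¬ IsSum s → isSumᵇ s ≡ false
  isSumᵇ-false {s} ¬σ with isSumᵇ s in σ
  ... | false = refl
  ... | true  = contradiction (isSumᵇ-sound σ) ¬σ

  sums nonSums : ℕ → ℕ
  sums    = count (λ i → isSumᵇ (suc i))
  nonSums = count (λ i → not (isSumᵇ (suc i)))

  isSumᵇ-shift₁ : ∀ k {i} → i < m k + m k → isSumᵇ (suc (a k + i)) ≡ isSumᵇ (suc i)
  isSumᵇ-shift₁ k {i} i<m+m = trans (cong isSumᵇ (sym (+-suc (a k) i))) (isSumᵇ-cong (IsSum-shift₁ k i<m+m))

  isSumᵇ-shift₂ : ∀ k {i} → i < m k + m k → isSumᵇ (suc (a k + a k + i)) ≡ isSumᵇ (suc i)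
  isSumᵇ-shift₂ k {i} i<m+m = trans (cong isSumᵇ (sym (+-suc (a k + a k) i))) (isSumᵇ-cong (IsSum-shift₂ k i<m+m))

  isSumᵇ-gap₁ : ∀ k {i} → m k + m k ≤ i → i < a k → isSumᵇ (suc i) ≡ false
  isSumᵇ-gap₁ k m+m≤i i<a = isSumᵇ-false (¬IsSum-gap₁ k (s≤s m+m≤i) (≤-trans i<a (m≤m+n (a k) 1)))

  isSumᵇ-gap₂ : ∀ k {i} → a k + (m k + m k) ≤ i → i < a k + a k → isSumᵇ (suc i) ≡ false
  isSumᵇ-gap₂ k a+m+m≤i i<2a = isSumᵇ-false (¬IsSum-gap₂ k (s≤s a+m+m≤i) (≤-trans i<2a (m≤m+n (a k + a k) 1)))

  sums-shift₁ : ∀ k {j} → j ≤ m k + m k → sums (a k + j) ≡ sums (a k) + sums j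
  sums-shift₁ k j≤m+m = count-shift _ (a k) _ (λ i i<j → isSumᵇ-shift₁ k (<-≤-trans i<j j≤m+m))

  sums-shift₂ : ∀ k {j} → j ≤ m k + m k → sums (a k + a k + j) ≡ sums (a k + a k) + sums j
  sums-shift₂ k j≤m+m = count-shift _ (a k + a k) _ (λ i i<j → isSumᵇ-shift₂ k (<-≤-trans i<j j≤m+m))

  sums-gap₁ : ∀ k → sums (a k) ≡ sums (m k + m k)
  sums-gap₁ k = count-gap _ (<⇒≤ (m+m<a k)) (λ i → isSumᵇ-gap₁ k)

  sums-gap₂ : ∀ k → sums (a k + a k) ≡ sums (a k + (m k + m k))
  sums-gap₂ k = count-gap _ (+-monoʳ-≤ (a k) (<⇒≤ (m+m<a k))) (λ i → isSumᵇ-gap₂ k)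

  sums-m : ∀ k → sums (m k) ≡ D k × sums (m k + m k) ≡ D k + E k
  sums-m zero = cong (λ b → (if b then 1 else 0) + 0) (isSumᵇ-false ¬IsSum-1)
              , cong₂ (λ b c → (if b then 1 else 0) + ((if c then 1 else 0) + 0))
                      (isSumᵇ-complete IsSum-2) (isSumᵇ-false ¬IsSum-1)
  sums-m (suc k) = low , high
    where
    M = m k
    A = a k
    low : sums (M + A) ≡ D (suc k)
    low = begin
      sums (M + A)               ≡⟨ cong sums (+-comm M A) ⟩
      sums (A + M)               ≡⟨ sums-shift₁ k (m≤m+n M M) ⟩
      sums A + sums M            ≡⟨ cong₂ _+_ (trans (sums-gap₁ k) (proj₂ (sums-m k))) (proj₁ (sums-m k)) ⟩
      D k + E k + D k            ≡⟨ regroup (D k) (E k) ⟩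
      D (suc k) ∎
      where
      open ≡-Reasoning
      regroup : ∀ d e → d + e + d ≡ d + d + e
      regroup = solve-∀
    high : sums ((M + A) + (M + A)) ≡ D (suc k) + E (suc k)
    high = begin
      sums ((M + A) + (M + A))               ≡⟨ cong sums (regroup₁ M A) ⟩
      sums (A + A + (M + M))                 ≡⟨ sums-shift₂ k ≤-refl ⟩
      sums (A + A) + sums (M + M)            ≡⟨ cong (_+ sums (M + M)) (sums-gap₂ k) ⟩
      sums (A + (M + M)) + sums (M + M)      ≡⟨ cong (_+ sums (M + M)) (sums-shift₁ k ≤-refl) ⟩
      sums A + sums (M + M) + sums (M + M)   ≡⟨ cong (λ t → t + sums (M + M) + sums (M + M)) (sums-gap₁ k) ⟩
      sums (M + M) + sums (M + M) + sums (M + M) ≡⟨ cong (λ t → t + t + t) (proj₂ (sums-m k)) ⟩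
      (D k + E k) + (D k + E k) + (D k + E k)    ≡⟨ regroup₂ (D k) (E k) ⟩
      D (suc k) + E (suc k) ∎
      where
      open ≡-Reasoning
      regroup₁ : ∀ u v → (u + v) + (u + v) ≡ v + v + (u + u)
      regroup₁ = solve-∀
      regroup₂ : ∀ d e → (d + e) + (d + e) + (d + e) ≡ (d + d + e) + (d + e + e)
      regroup₂ = solve-∀

  nonSums-m : ∀ k → nonSums (m k) ≡ N k
  nonSums-m k = +-cancelˡ-≡ (D k) _ _ (begin
      D k + nonSums (m k)         ≡⟨ cong (_+ nonSums (m k)) (proj₁ (sums-m k)) ⟨
      sums (m k) + nonSums (m k)  ≡⟨ count+count-not _ (m k) ⟩
      m k                         ≡⟨ m≡D+N k ⟩
      D k + N k ∎)
    where open ≡-Reasoning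

  nonSums-a : ∀ k → nonSums (a k) ≡ N k + l * N k
  nonSums-a k = +-cancelˡ-≡ (D k + E k) _ _ (begin
      D k + E k + nonSums (a k)   ≡⟨ cong (_+ nonSums (a k)) (trans (sums-gap₁ k) (proj₂ (sums-m k))) ⟨
      sums (a k) + nonSums (a k)  ≡⟨ count+count-not _ (a k) ⟩
      m k + E k + l * N k         ≡⟨ cong (λ t → t + E k + l * N k) (m≡D+N k) ⟩
      D k + N k + E k + l * N k   ≡⟨ regroup (D k) (N k) (E k) (l * N k) ⟩
      D k + E k + (N k + l * N k) ∎)
    where
    open ≡-Reasoning
    regroup : ∀ d n e x → d + n + e + x ≡ d + e + (n + x)
    regroup = solve-∀

  nonSums-suc : ∀ n → isSumᵇ (suc n) ≡ false → nonSums (suc n) ≡ suc (nonSums n)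
  nonSums-suc n σ = cong (λ b → (if not b then 1 else 0) + nonSums n) σ

  inT-shift : ∀ k {i} → i ≤ m k → inT (a k + i) ≡ inT i
  inT-shift k {i} i≤m = begin
      inT (a k + i)            ≡⟨ inT-inBlock (suc k) (≤-trans (subst (a k + i ≤_) (+-comm (a k) (m k)) (+-monoʳ-≤ (a k) i≤m)) (m≤a (suc k))) ⟩
      inBlock (suc k) (a k + i) ≡⟨ inBlock-suc-shift k i ⟩
      inBlock k i              ≡⟨ inT-inBlock k (≤-trans i≤m (m≤a k)) ⟨
      inT i ∎
    where open ≡-Reasoning

  inT-gap : ∀ k {i} → m k < i → i ≤ a k → inT i ≡ false
  inT-gap k m<i i≤a = trans (inT-inBlock k i≤a) (inBlock-above k m<i)

  -- θ examines n + 1 after having read nonSums n symbols of c.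
  Consistent : ℕ → Set
  Consistent n = (isSumᵇ (suc n) ≡ true → inT (suc n) ≡ false)
               × (isSumᵇ (suc n) ≡ false → fixedPoint l (nonSums n) ≡ inT (suc n))

  nonSums-shift₁ : ∀ k {j} → j ≤ m k + m k → nonSums (a k + j) ≡ nonSums (a k) + nonSums j
  nonSums-shift₁ k j≤m+m = count-shift _ (a k) _ (λ i i<j → cong not (isSumᵇ-shift₁ k (<-≤-trans i<j j≤m+m)))

  read-zeros : ∀ k {n} → m k ≤ n → n < a k → isSumᵇ (suc n) ≡ false → fixedPoint l (nonSums n) ≡ false
  read-zeros k {n} m≤n n<a σ with m≤n⇒∃[o]m+o≡n (subst (_≤ nonSums n) (nonSums-m k) (count-mono _ m≤n))
  ... | j , N+j≡r = subst (λ t → fixedPoint l t ≡ false) N+j≡r (fixedPoint-zeros k (+-cancelˡ-< (N k) j _ (begin-strict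
      N k + j             ≡⟨ N+j≡r ⟩
      nonSums n           <⟨ n<1+n (nonSums n) ⟩
      suc (nonSums n)     ≡⟨ nonSums-suc n σ ⟨
      nonSums (suc n)     ≤⟨ count-mono _ n<a ⟩
      nonSums (a k)       ≡⟨ nonSums-a k ⟩
      N k + l * N k ∎)))
    where open ≤-Reasoning

  consistent-block : ∀ k n → suc n ≤ m k → Consistent n
  consistent-block zero zero _ = (λ σ → contradiction (isSumᵇ-sound σ) ¬IsSum-1) , λ _ → refl
  consistent-block zero (suc n) (s≤s ())
  consistent-block (suc k) n n<m′ with suc n ≤? m k
  ... | yes n<m = consistent-block k n n<m
  ... | no  n≮m with suc n ≤? a k
  ...   | yes n<a = (λ _ → gap) , (λ σ → trans (read-zeros k (≤-pred (≰⇒> n≮m)) n<a σ) (sym gap))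
    where gap = inT-gap k (≰⇒> n≮m) n<a
  ...   | no  n≮a with m≤n⇒∃[o]m+o≡n (≤-pred (≰⇒> n≮a))
  ...     | j , refl = (λ σ → trans inT≡ (proj₁ ih (trans (sym isSum≡) σ)))
                     , (λ σ → read≡ (trans (sym isSum≡) σ))
    where
    j<m : suc j ≤ m k
    j<m = +-cancelˡ-≤ (a k) (suc j) (m k) (subst₂ _≤_ (sym (+-suc (a k) j)) (+-comm (m k) (a k)) n<m′)
    ih = consistent-block k j j<m
    isSum≡ : isSumᵇ (suc (a k + j)) ≡ isSumᵇ (suc j)
    isSum≡ = isSumᵇ-shift₁ k (≤-trans j<m (m≤m+n (m k) (m k)))
    inT≡ : inT (suc (a k + j)) ≡ inT (suc j)
    inT≡ = trans (cong inT (sym (+-suc (a k) j))) (inT-shift k j<m)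
    read≡ : isSumᵇ (suc j) ≡ false → fixedPoint l (nonSums (a k + j)) ≡ inT (suc (a k + j))
    read≡ σ = begin
        fixedPoint l (nonSums (a k + j))               ≡⟨ cong (fixedPoint l) (nonSums-shift₁ k (≤-trans (n≤1+n j) (≤-trans j<m (m≤m+n (m k) (m k))))) ⟩
        fixedPoint l (nonSums (a k) + nonSums j)       ≡⟨ cong (λ t → fixedPoint l (t + nonSums j)) (nonSums-a k) ⟩
        fixedPoint l (N k + l * N k + nonSums j)       ≡⟨ fixedPoint-repeat k read<N ⟩
        fixedPoint l (nonSums j)                       ≡⟨ proj₂ ih σ ⟩
        inT (suc j)                                    ≡⟨ inT≡ ⟨
        inT (suc (a k + j)) ∎
      where
      open ≡-Reasoning
      read<N : nonSums j < N k
      read<N = subst₂ _≤_ (nonSums-suc j σ) (nonSums-m k) (count-mono _ j<m)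

  consistent : ∀ n → Consistent n
  consistent n = consistent-block n n (k<m n)

module Theta (l : ℕ) (2≤l : 2 ≤ l) where
  open SumFreeBlocks l 2≤l public

  Invariant : ℕ → List ℕ × ℕ → Set
  Invariant n (S , r) = (∀ x → memᵇ x S ≡ (x ≤ᵇ n) ∧ inT x) × r ≡ nonSums n

  inT-pos : ∀ {x} → inT x ≡ true → 1 ≤ x
  inT-pos {x} x∈ = proj₁ (inBlock-bounds x x x∈)

  isSum≡isSumᵇ : ∀ n S → (∀ x → memᵇ x S ≡ (x ≤ᵇ n) ∧ inT x) → isSum S (suc n) ≡ isSumᵇ (suc n)
  isSum≡isSumᵇ n S S≡T = true-⇔⇒≡ (mk⇔ to from)
    where
    member : ∀ {x} → memᵇ x S ≡ true → inT x ≡ true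
    member {x} x∈S = proj₂ (∧-≡-true (trans (sym (S≡T x)) x∈S))
    to : isSum S (suc n) ≡ true → isSumᵇ (suc n) ≡ true
    to σ with any-sound _ S σ
    ... | x , x∈S , τ with any-sound _ S τ
    ...   | y , y∈S , x+y≡ = isSumᵇ-complete (x , y , member x∈S , member y∈S , ≡ᵇ⇒≡ (x + y) (suc n) (Equivalence.from T-≡ x+y≡))
    listed : ∀ {x} → x ≤ n → inT x ≡ true → memᵇ x S ≡ true
    listed {x} x≤n x∈ = trans (S≡T x) (cong₂ _∧_ (Equivalence.to T-≡ (≤⇒≤ᵇ x≤n)) x∈)
    from : isSumᵇ (suc n) ≡ true → isSum S (suc n) ≡ true
    from σ with isSumᵇ-sound σ
    ... | x , y , x∈ , y∈ , x+y≡ =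
      any-complete _ S (listed x≤n x∈) (any-complete _ S (listed y≤n y∈) (Equivalence.to T-≡ (≡⇒≡ᵇ (x + y) (suc n) x+y≡)))
      where
      x≤n : x ≤ n
      x≤n = ≤-pred (subst (suc x ≤_) x+y≡ (subst (_≤ x + y) (+-comm x 1) (+-monoʳ-≤ x (inT-pos y∈))))
      y≤n : y ≤ n
      y≤n = ≤-pred (subst (suc y ≤_) x+y≡ (+-monoˡ-≤ y (inT-pos x∈)))

  listed-skip : ∀ n x → inT (suc n) ≡ false → (x ≤ᵇ n) ∧ inT x ≡ (x ≤ᵇ suc n) ∧ inT x
  listed-skip n x ∉ = sym (begin
      (x ≤ᵇ suc n) ∧ inT x                                ≡⟨ ≤ᵇ-suc-∧ inT n x ⟩
      (suc n ≡ᵇ x) ∧ inT (suc n) ∨ (x ≤ᵇ n) ∧ inT x        ≡⟨ cong (λ b → (suc n ≡ᵇ x) ∧ b ∨ (x ≤ᵇ n) ∧ inT x) ∉ ⟩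
      (suc n ≡ᵇ x) ∧ false ∨ (x ≤ᵇ n) ∧ inT x              ≡⟨ cong (_∨ (x ≤ᵇ n) ∧ inT x) (∧-zeroʳ (suc n ≡ᵇ x)) ⟩
      (x ≤ᵇ n) ∧ inT x ∎)
    where open ≡-Reasoning

  listed-add : ∀ n x → inT (suc n) ≡ true → (suc n ≡ᵇ x) ∨ (x ≤ᵇ n) ∧ inT x ≡ (x ≤ᵇ suc n) ∧ inT x
  listed-add n x ∈ = sym (begin
      (x ≤ᵇ suc n) ∧ inT x                                ≡⟨ ≤ᵇ-suc-∧ inT n x ⟩
      (suc n ≡ᵇ x) ∧ inT (suc n) ∨ (x ≤ᵇ n) ∧ inT x        ≡⟨ cong (λ b → (suc n ≡ᵇ x) ∧ b ∨ (x ≤ᵇ n) ∧ inT x) ∈ ⟩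
      (suc n ≡ᵇ x) ∧ true ∨ (x ≤ᵇ n) ∧ inT x               ≡⟨ cong (_∨ (x ≤ᵇ n) ∧ inT x) (∧-identityʳ (suc n ≡ᵇ x)) ⟩
      (suc n ≡ᵇ x) ∨ (x ≤ᵇ n) ∧ inT x ∎)
    where open ≡-Reasoning

  invariant-step : ∀ n S r → Invariant n (S , r) →
    Invariant (suc n) (if isSum S (suc n) then (S , r)
                       else (if fixedPoint l r then (suc n ∷ S , suc r) else (S , suc r)))
  invariant-step n S r (S≡T , refl) rewrite isSum≡isSumᵇ n S S≡T with isSumᵇ (suc n) in σ
  ... | true  = (λ x → trans (S≡T x) (listed-skip n x (proj₁ (consistent n) σ))) , refl
  ... | false rewrite proj₂ (consistent n) σ with inT (suc n) in n+1∈
  ...   | true  = (λ x → trans (cong ((suc n ≡ᵇ x) ∨_) (S≡T x)) (listed-add n x n+1∈)) , refl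
  ...   | false = (λ x → trans (S≡T x) (listed-skip n x n+1∈)) , refl

  invariant : ∀ n → Invariant n (θstate (fixedPoint l) n)
  invariant zero = (λ { zero → refl ; (suc x) → refl }) , refl
  invariant (suc n) with θstate (fixedPoint l) n | invariant n
  ... | S , r | inv = invariant-step n S r inv

  θmem≡inT : ∀ x → θmem (fixedPoint l) x ≡ inT x
  θmem≡inT x = trans (proj₁ (invariant x) x) (cong (_∧ inT x) (Equivalence.to T-≡ (≤⇒≤ᵇ (≤-refl {x}))))

  θcount≡count-inT : ∀ x → θcount (fixedPoint l) x ≡ count inT x
  θcount≡count-inT zero    = refl
  θcount≡count-inT (suc x) = cong₂ (λ b c → (if b then 1 else 0) + c) (θmem≡inT x) (θcount≡count-inT x)

module Elements (l : ℕ) (2≤l : 2 ≤ l) where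
  open Theta l 2≤l public

  count-inT-m : ∀ k → count inT (suc (m k)) ≡ 2 ^ k
  count-inT-a : ∀ k → count inT (a k) ≡ 2 ^ k
  count-inT-m zero    = refl
  count-inT-m (suc k) = begin
      count inT (suc (m k + a k))                 ≡⟨ cong (count inT) (trans (cong suc (+-comm (m k) (a k))) (sym (+-suc (a k) (m k)))) ⟩
      count inT (a k + suc (m k))                 ≡⟨ count-shift inT (a k) (suc (m k)) (λ i i≤m → inT-shift k (≤-pred i≤m)) ⟩
      count inT (a k) + count inT (suc (m k))     ≡⟨ cong₂ _+_ (count-inT-a k) (count-inT-m k) ⟩
      2 ^ k + 2 ^ k                               ≡⟨ cong (2 ^ k +_) (+-identityʳ (2 ^ k)) ⟨
      2 ^ suc k ∎
    where open ≡-Reasoning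
  count-inT-a k = trans (count-gap inT (≤-trans (s≤s (m≤m+n (m k) (m k))) (m+m<a k)) (λ i m<i i<a → inT-gap k m<i (<⇒≤ i<a)))
                        (count-inT-m k)

  a≡3^k+[1+l]N : ∀ k → a k ≡ 3 ^ k + (1 + l) * N k
  a≡3^k+[1+l]N k = begin
      m k + E k + l * N k          ≡⟨ cong (λ t → t + E k + l * N k) (m≡D+N k) ⟩
      D k + N k + E k + l * N k    ≡⟨ regroup (D k) (N k) (E k) l ⟩
      D k + E k + (1 + l) * N k    ≡⟨ cong (_+ (1 + l) * N k) (D+E≡3^k k) ⟩
      3 ^ k + (1 + l) * N k ∎
    where
    open ≡-Reasoning
    regroup : ∀ d n e x → d + n + e + x * n ≡ d + e + (1 + x) * n
    regroup = solve-∀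

  parity-3^k : ∀ k → parity (3 ^ k) ≡ 1ℙ
  parity-3^k zero    = refl
  parity-3^k (suc k) = trans (*-homo-* 3 (3 ^ k)) (cong (1ℙ ℙ.*_) (parity-3^k k))

  parity-[1+l]N : ∀ k → parity ((1 + l) * N k) ≡ parity ((1 + l) * 2 ^ k)
  parity-[1+l]N zero    = refl
  parity-[1+l]N (suc k) = begin
      parity ((1 + l) * N (suc k))                          ≡⟨ *-homo-* (1 + l) (N (suc k)) ⟩
      parity (1 + l) ℙ.* parity ((2 + l) * N k)             ≡⟨ cong₂ ℙ._*_ (+-homo-+ 1 l) (*-homo-* (2 + l) (N k)) ⟩
      (1ℙ ℙ.+ parity l) ℙ.* (parity l ℙ.* parity (N k))     ≡⟨ [1+p]*[p*q]≡0ℙ (parity l) (parity (N k)) ⟩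
      0ℙ                                                    ≡⟨ ℙₚ.*-zeroʳ (parity (1 + l)) ⟨
      parity (1 + l) ℙ.* (0ℙ ℙ.* parity (2 ^ k))            ≡⟨ cong (parity (1 + l) ℙ.*_) (*-homo-* 2 (2 ^ k)) ⟨
      parity (1 + l) ℙ.* parity (2 ^ suc k)                 ≡⟨ *-homo-* (1 + l) (2 ^ suc k) ⟨
      parity ((1 + l) * 2 ^ suc k) ∎
    where
    open ≡-Reasoning
    [1+p]*[p*q]≡0ℙ : ∀ p q → (1ℙ ℙ.+ p) ℙ.* (p ℙ.* q) ≡ 0ℙ
    [1+p]*[p*q]≡0ℙ 0ℙ q = refl
    [1+p]*[p*q]≡0ℙ 1ℙ q = refl

  parity-a : ∀ k → parity (a k) ≡ parity (1 + (1 + l) * 2 ^ k)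
  parity-a k = begin
      parity (a k)                                      ≡⟨ cong parity (a≡3^k+[1+l]N k) ⟩
      parity (3 ^ k + (1 + l) * N k)                    ≡⟨ +-homo-+ (3 ^ k) _ ⟩
      parity (3 ^ k) ℙ.+ parity ((1 + l) * N k)         ≡⟨ cong₂ ℙ._+_ (parity-3^k k) (parity-[1+l]N k) ⟩
      1ℙ ℙ.+ parity ((1 + l) * 2 ^ k)                   ≡⟨ +-homo-+ 1 ((1 + l) * 2 ^ k) ⟨
      parity (1 + (1 + l) * 2 ^ k) ∎
    where open ≡-Reasoning

  ElementParity : ℕ → ℕ → Set
  ElementParity n s = parity s ≡ parity (1 + digitSum n + (1 + l) * n)

  elementParity-shift : ∀ k {r s} → r < 2 ^ k → ElementParity r s → ElementParity (2 ^ k + r) (a k + s)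
  elementParity-shift k {r} {s} r<2^k ps = begin
      parity (a k + s)                                                  ≡⟨ +-homo-+ (a k) s ⟩
      parity (a k) ℙ.+ parity s                                         ≡⟨ cong₂ ℙ._+_ (parity-a k) ps ⟩
      parity (1 + (1 + l) * 2 ^ k) ℙ.+ parity (1 + digitSum r + (1 + l) * r)  ≡⟨ +-homo-+ (1 + (1 + l) * 2 ^ k) _ ⟨
      parity (1 + (1 + l) * 2 ^ k + (1 + digitSum r + (1 + l) * r))     ≡⟨ cong parity (regroup l (2 ^ k) (digitSum r) r) ⟩
      parity (1 + suc (digitSum r) + (1 + l) * (2 ^ k + r))             ≡⟨ cong (λ t → parity (1 + t + (1 + l) * (2 ^ k + r))) (digitSum-2^k+ k r<2^k) ⟨
      parity (1 + digitSum (2 ^ k + r) + (1 + l) * (2 ^ k + r)) ∎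
    where
    open ≡-Reasoning
    regroup : ∀ x p d r → 1 + (1 + x) * p + (1 + d + (1 + x) * r) ≡ 1 + (1 + d) + (1 + x) * (p + r)
    regroup = solve-∀

  element-block : ∀ k n → n < 2 ^ k → ∃ λ s → inT s ≡ true × s ≤ m k × count inT s ≡ n × ElementParity n s
  element-block zero zero _ = 1 , refl , ≤-refl , refl , cong (parity ∘ suc) (sym (*-zeroʳ (1 + l)))
  element-block zero (suc n) (s≤s ())
  element-block (suc k) n n<2^k+1 with n <? 2 ^ k
  ... | yes n<2^k = let s , s∈ , s≤m , count≡n , ps = element-block k n n<2^k
                    in s , s∈ , ≤-trans s≤m (m≤m+n (m k) (a k)) , count≡n , ps
  ... | no  n≮2^k with m≤n⇒∃[o]m+o≡n (≮⇒≥ n≮2^k)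
  ...   | r , refl = let s , s∈ , s≤m , count≡r , ps = element-block k r r<2^k
                     in a k + s
                      , trans (inT-shift k s≤m) s∈
                      , subst (a k + s ≤_) (+-comm (a k) (m k)) (+-monoʳ-≤ (a k) s≤m)
                      , trans (count-shift inT (a k) s (λ i i<s → inT-shift k (≤-trans (<⇒≤ i<s) s≤m))) (cong₂ _+_ (count-inT-a k) count≡r)
                      , elementParity-shift k r<2^k ps
    where
    r<2^k : r < 2 ^ k
    r<2^k = +-cancelˡ-< (2 ^ k) r (2 ^ k) (subst (2 ^ k + r <_) (cong (2 ^ k +_) (+-identityʳ (2 ^ k))) n<2^k+1)

  nth-element : ∀ n → ∃ λ s → IsNth (fixedPoint l) n s × ElementParity n s
  nth-element n = let s , s∈ , _ , count≡n , ps = element-block n n (n<m^n 2 n (s≤s (s≤s z≤n)))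
                  in s , (trans (θmem≡inT s) s∈ , trans (θcount≡count-inT s) count≡n) , ps

  parity-+-even : ∀ x {z} → parity z ≡ 0ℙ → parity (x + z) ≡ parity x
  parity-+-even x {z} pz = trans (+-homo-+ x z) (trans (cong (parity x ℙ.+_) pz) (ℙₚ.+-identityʳ (parity x)))

  parity-[1+l]* : ∀ n → parity ((1 + l) * n) ≡ (1ℙ ℙ.+ parity l) ℙ.* parity n
  parity-[1+l]* n = trans (*-homo-* (1 + l) n) (cong (ℙ._* parity n) (+-homo-+ 1 l))

  element-%2-odd : l % 2 ≡ 1 → ∀ n s → ElementParity n s → s % 2 ≡ 1 ∸ thueMorse n
  element-%2-odd l%2≡1 n s ps = %2≡1∸%2 s (digitSum n) (trans ps (parity-+-even (1 + digitSum n) [1+l]n-even))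
    where
    [1+l]n-even : parity ((1 + l) * n) ≡ 0ℙ
    [1+l]n-even = trans (parity-[1+l]* n) (cong (λ p → (1ℙ ℙ.+ p) ℙ.* parity n) (%2≡1⇒parity≡1ℙ l l%2≡1))

  tm-even₀ : l % 2 ≡ 0 → ∀ n s → ElementParity (2 * n) s → s % 2 ≡ 1 ∸ thueMorse n
  tm-even₀ l%2≡0 n s ps = %2≡1∸%2 s (digitSum n) (trans ps (begin
      parity (1 + digitSum (2 * n) + (1 + l) * (2 * n))   ≡⟨ parity-+-even (1 + digitSum (2 * n)) [1+l]2n-even ⟩
      parity (1 + digitSum (2 * n))                       ≡⟨ cong (parity ∘ suc) (trans (cong digitSum (*-comm 2 n)) (digitSum-double 0 n (s≤s z≤n))) ⟩
      parity (1 + digitSum n) ∎))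
    where
    open ≡-Reasoning
    [1+l]2n-even : parity ((1 + l) * (2 * n)) ≡ 0ℙ
    [1+l]2n-even = trans (parity-[1+l]* (2 * n))
                         (trans (cong (λ p → (1ℙ ℙ.+ p) ℙ.* parity (2 * n)) (%2≡0⇒parity≡0ℙ l l%2≡0)) (*-homo-* 2 n))

  tm-even₁ : l % 2 ≡ 0 → ∀ n s → ElementParity (2 * n + 1) s → s % 2 ≡ 1 ∸ thueMorse n
  tm-even₁ l%2≡0 n s ps = %2≡1∸%2 s (digitSum n) (trans ps (begin
      parity (1 + digitSum (2 * n + 1) + z)       ≡⟨ cong (λ t → parity (1 + t + z)) digitSum-odd ⟩
      parity (1 + (1 + digitSum n) + z)           ≡⟨ cong parity (+-assoc 1 (1 + digitSum n) z) ⟩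
      parity (1 + ((1 + digitSum n) + z))         ≡⟨ cong parity (x∙yz≈y∙xz 1 (1 + digitSum n) z) ⟩
      parity ((1 + digitSum n) + (1 + z))         ≡⟨ parity-+-even (1 + digitSum n) 1+z-even ⟩
      parity (1 + digitSum n) ∎))
    where
    open ≡-Reasoning
    z = (1 + l) * (2 * n + 1)
    digitSum-odd : digitSum (2 * n + 1) ≡ 1 + digitSum n
    digitSum-odd = trans (cong digitSum (trans (+-comm (2 * n) 1) (cong (1 +_) (*-comm 2 n)))) (digitSum-double 1 n ≤-refl)
    1+z-even : parity (1 + z) ≡ 0ℙ
    1+z-even = begin
      parity (1 + z)                                          ≡⟨ +-homo-+ 1 z ⟩
      1ℙ ℙ.+ parity z                                         ≡⟨ cong (1ℙ ℙ.+_) (parity-[1+l]* (2 * n + 1)) ⟩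
      1ℙ ℙ.+ ((1ℙ ℙ.+ parity l) ℙ.* parity (2 * n + 1))       ≡⟨ cong (λ p → 1ℙ ℙ.+ ((1ℙ ℙ.+ p) ℙ.* parity (2 * n + 1))) (%2≡0⇒parity≡0ℙ l l%2≡0) ⟩
      1ℙ ℙ.+ parity (2 * n + 1)                               ≡⟨ cong (1ℙ ℙ.+_) (trans (+-homo-+ (2 * n) 1) (cong (ℙ._+ 1ℙ) (*-homo-* 2 n))) ⟩
      0ℙ ∎

mainTheorem9 : (l : ℕ) → 2 ≤ l →
    ((l % 2 ≡ 1) →
      (n : ℕ) → Σ ℕ (λ m → IsNth (fixedPoint l) n m × (m % 2 ≡ 1 ∸ thueMorse n)))
    × ((l % 2 ≡ 0) →
      (n : ℕ) → Σ ℕ (λ a → Σ ℕ (λ b →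
        IsNth (fixedPoint l) (2 * n) a × IsNth (fixedPoint l) (2 * n + 1) b
        × (a % 2 ≡ 1 ∸ thueMorse n) × (b % 2 ≡ 1 ∸ thueMorse n))))
mainTheorem9 l 2≤l = odd-case , even-case
  where
  open Elements l 2≤l
  odd-case : l % 2 ≡ 1 → (n : ℕ) → Σ ℕ (λ m → IsNth (fixedPoint l) n m × (m % 2 ≡ 1 ∸ thueMorse n))
  odd-case l%2≡1 n =
    let s , s-isNth , ps = nth-element n
    in s , s-isNth , element-%2-odd l%2≡1 n s ps
  even-case : l % 2 ≡ 0 → (n : ℕ) → Σ ℕ (λ a → Σ ℕ (λ b →
        IsNth (fixedPoint l) (2 * n) a × IsNth (fixedPoint l) (2 * n + 1) b
        × (a % 2 ≡ 1 ∸ thueMorse n) × (b % 2 ≡ 1 ∸ thueMorse n)))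
  even-case l%2≡0 n =
    let s , s-isNth , ps = nth-element (2 * n)
        t , t-isNth , pt = nth-element (2 * n + 1)
    in s , t , s-isNth , t-isNth , tm-even₀ l%2≡0 n s ps , tm-even₁ l%2≡0 n t pt
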